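{- Let $H=(V,E)$ be a $3$-graph on $n\ge 6$ vertices containing no copy of $K_5^{(3)}$, such that $H^{c}$ has more than one connected component. If $n=2m$, then $|E^{c}|\ge 2\binom{m}{3}$, equivalently $|E|\le m^2(m-1)$, with equality if and only if $H^{c}$ is the disjoint union of two copies of $K_m^{(3)}$. If $n=2m+1$, then $|E^{c}|\ge \binom{m}{3}+\binom{m+1}{3}$, equivalently $|E|\le m^3+\frac{m^2}{2}-\frac{m}{2}$, with equality if and only if $H^{c}$ is the disjoint union of $K_m^{(3)}$ and $K_{m+1}^{(3)}$.
   Context: A $3$-graph is a pair $(V,E)$ with $V$ finite and $E$ a set of $3$-element subsets of $V$. $K_s^{(3)}$ is the complete $3$-graph on $s$ vertices; "$H$ contains no copy of $K_5^{(3)}$" means there are no $5$ vertices all of whose $3$-subsets are edges. The complement is $H^{c}=(V,E^{c})$ with $E^{c}$ the set of $3$-subsets of $V$ not in $E$. Connected components are in the usual hypergraph sense, isolated vertices counting as components. -}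

module Defs where

open import Data.Nat using (ℕ; zero; suc; _+_; _*_; _<ᵇ_)
open import Data.Bool using (Bool; true; false; not; if_then_else_; _∧_)
open import Data.Fin using (Fin; toℕ)
open import Data.List using (List; []; _∷_; concatMap; map; allFin)
open import Data.Nat.ListAction using (sum)
open import Data.Product using (_×_; _,_; Σ; ∃)
open import Relation.Binary.PropositionalEquality using (_≡_; _≢_)
open import Relation.Nullary using (¬_)
open import Relation.Binary.Construct.Closure.ReflexiveTransitive using (Star)
open import Function.Bundles using (_⇔_)
open import Function.Definitions using (Injective)

-- The function is required to
-- be symmetric, so its value depends only on the set {a,b,c}; values on
-- triples with repeated vertices are irrelevant (never consulted).
record Graph3 (n : ℕ) : Set where
  field
    edge  : Fin n → Fin n → Fin n → Bool
    sym₁₂ : ∀ a b c → edge a b c ≡ edge b a c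
    sym₂₃ : ∀ a b c → edge a b c ≡ edge a c b
open Graph3 public

Distinct3 : ∀ {n} → Fin n → Fin n → Fin n → Set
Distinct3 a b c = a ≢ b × b ≢ c × a ≢ c

IsEdge : ∀ {n} → Graph3 n → Fin n → Fin n → Fin n → Set
IsEdge H a b c = Distinct3 a b c × edge H a b c ≡ true

compl : ∀ {n} → Graph3 n → Graph3 n
compl H = record
  { edge  = λ a b c → not (edge H a b c)
  ; sym₁₂ = λ a b c → cong′ (sym₁₂ H a b c)
  ; sym₂₃ = λ a b c → cong′ (sym₂₃ H a b c) }
  where
  cong′ : ∀ {x y : Bool} → x ≡ y → not x ≡ not y
  cong′ Relation.Binary.PropositionalEquality.refl = Relation.Binary.PropositionalEquality.refl

-- all triples (i , j , k) with i < j < k: one per 3-subset of Fin n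
triples : (n : ℕ) → List (Fin n × Fin n × Fin n)
triples n =
  concatMap (λ i → concatMap (λ j → concatMap (λ k →
    if (toℕ i <ᵇ toℕ j) ∧ (toℕ j <ᵇ toℕ k) then (i , j , k) ∷ [] else [])
    (allFin n)) (allFin n)) (allFin n)

numEdges : ∀ {n} → Graph3 n → ℕ
numEdges {n} H =
  sum (map (λ { (i , j , k) → if edge H i j k then 1 else 0 }) (triples n))

K5Free : ∀ {n} → Graph3 n → Set
K5Free {n} H = ¬ (Σ (Fin 5 → Fin n) λ f → Injective _≡_ _≡_ f ×
  (∀ i j k → Distinct3 i j k → edge H (f i) (f j) (f k) ≡ true))

Adj : ∀ {n} → Graph3 n → Fin n → Fin n → Set
Adj H u v = ∃ λ w → IsEdge H u v w

-- more than one connected component (hypergraph sense; isolated vertices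
-- are components): some two vertices are not joined by a path
Disconnected : ∀ {n} → Graph3 n → Set
Disconnected H = ∃ λ u → ∃ λ v → ¬ Star (Adj H) u v

countTrue : ∀ {n} → (Fin n → Bool) → ℕ
countTrue {n} s = sum (map (λ v → if s v then 1 else 0) (allFin n))

-- G is (a relabelling of) the disjoint union of K_p^(3) and K_q^(3):
-- a 2-colouring of the vertices with p vertices of colour true and q of
-- colour false, whose edges are exactly the monochromatic 3-subsets.
DisjUnionCliques : ∀ {n} → Graph3 n → ℕ → ℕ → Set
DisjUnionCliques {n} G p q = Σ (Fin n → Bool) λ s →
  countTrue s ≡ p × countTrue (λ v → not (s v)) ≡ q ×
  (∀ a b c → Distinct3 a b c →
     (edge G a b c ≡ true) ⇔ (s a ≡ s b × s b ≡ s c))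

-- Colour the vertices by the two sides of a disconnected H^c, so that every triple meeting both
-- colours is an edge of H.  If both colour classes have at least two vertices, K₅-freeness forces
-- every monochromatic triple to be a non-edge, so H^c is exactly the union of the two cliques and
-- C(a,3) + C(b,3) with a + b = n is minimised by the balanced split.  If one class is a single
-- vertex x₀, every 4-set on the other side spans an edge of H^c (else it forms a K₅ with x₀); the
-- averaging (Katona-type) argument then gives at least 3/10 of all C(n-1,3) triples, which is
-- strictly more than the balanced value.  Connectivity is only available classically, but every
-- conclusion is decidable, so double negation can be removed at the end.
module Submission where

open import Defs
open import Data.Nat using (ℕ; _+_; _*_; _∸_; _≤_)
open import Data.Nat.Combinatorics using (_C_)
open import Data.Product using (_×_)
open import Relation.Binary.PropositionalEquality using (_≡_)
open import Function.Bundles using (_⇔_)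

open import Data.Nat.Properties
open import Algebra.Properties.CommutativeSemigroup +-commutativeSemigroup using ()
  renaming (x∙yz≈y∙xz to x+[y+z]≡y+[x+z])
open import Algebra.Properties.CommutativeSemigroup *-commutativeSemigroup using ()
  renaming (x∙yz≈y∙xz to x*[y*z]≡y*[x*z])
open import Algebra.Properties.Semiring.Sum +-*-semiring
  using (sum; sum-syntax; sum-cong-≗; ∑-distrib-+; ∑-comm; *-distribˡ-sum; *-distribʳ-sum; sum-remove; sum-replicate-zero)
open import Data.Bool using (Bool; true; false; not; _∧_; if_then_else_)
open import Data.Bool.Properties using (∧-zeroʳ; ∧-identityʳ; ∧-assoc; not-involutive; T-≡)
import Data.Bool.Properties as Boolₚ
open import Data.Empty using (⊥)
open import Data.Fin using (Fin; toℕ) renaming (zero to fzero; suc to fsuc)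
import Data.Fin as Fin
import Data.Fin.Properties as Finₚ
open import Data.Fin.Subset.Properties using (anySubset?)
import Data.List as List hiding (sum)
import Data.List.Properties as List
open import Data.List.Membership.Propositional using (_∈_; lose)
open import Data.List.Membership.Propositional.Properties using (∈-concatMap⁺; ∈-allFin)
open import Data.List.Relation.Unary.All using (All; []; _∷_)
import Data.List.Relation.Unary.All as All
open import Data.List.Relation.Unary.Any using (here)
import Data.Nat as ℕ
open import Data.Nat using (zero; suc; _<_; _<ᵇ_; z≤n; s≤s; z<s)
open import Data.Nat.Combinatorics using (nCk+nC[k+1]≡[n+1]C[k+1]; nC1≡n)
import Data.Nat.ListAction as List
open import Data.Nat.ListAction.Properties using (sum-++)
open import Data.Nat.Tactic.RingSolver using (solve-∀)
open import Data.Product using (Σ; ∃; ∃-syntax; _,_; proj₁; proj₂; uncurry)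
open import Data.Sum using (_⊎_; inj₁; inj₂)
open import Data.Vec using (Vec; lookup; tabulate; []; _∷_)
open import Data.Vec.Properties using (lookup∘tabulate)
open import Data.Vec.Relation.Unary.All using ([]; _∷_)
import Data.Vec.Relation.Unary.All as VecAll
open import Data.Vec.Relation.Unary.AllPairs using ([]; _∷_)
open import Data.Vec.Relation.Unary.Unique.Propositional using (Unique)
open import Data.Vec.Relation.Unary.Unique.Propositional.Properties using (lookup-injective)
open import Function using (_∘_; id; case_of_)
open import Function.Bundles using (Equivalence; mk⇔)
open import Relation.Binary.Construct.Closure.ReflexiveTransitive using (Star; ε; _◅_; _◅◅_)
open import Relation.Binary.Definitions using (tri<; tri≈; tri>)
open import Relation.Binary.PropositionalEquality using (refl; sym; trans; cong; cong₂; subst; _≢_; module ≡-Reasoning)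
open import Relation.Nullary using (¬_; does; yes; no; contradiction)
open import Relation.Nullary.Decidable
  using (Dec; dec-true; dec-false; does-⇔; ¬¬-excluded-middle; map′; _×-dec_; _→-dec_; ¬?; decidable-stable)
open import Relation.Nullary.Negation using (¬¬-map)

∑-mono-≤ : ∀ {n} {f g : Fin n → ℕ} → (∀ i → f i ≤ g i) → sum f ≤ sum g
∑-mono-≤ {zero} f≤g = z≤n
∑-mono-≤ {suc n} f≤g = +-mono-≤ (f≤g fzero) (∑-mono-≤ (f≤g ∘ fsuc))

term≤∑ : ∀ {n} (f : Fin n → ℕ) i → f i ≤ sum f
term≤∑ {suc n} f i = subst (f i ≤_) (sym (sum-remove f)) (m≤m+n _ _)

sum-map-allFin : ∀ {n} (f : Fin n → ℕ) → List.sum (List.map f (List.allFin n)) ≡ sum f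
sum-map-allFin {n} f = trans (cong List.sum (List.map-tabulate id f)) (sum-tabulate f)
  where
  sum-tabulate : ∀ {n} (f : Fin n → ℕ) → List.sum (List.tabulate f) ≡ sum f
  sum-tabulate {zero} f = refl
  sum-tabulate {suc n} f = cong (f fzero +_) (sum-tabulate (f ∘ fsuc))

sum-concatMap-allFin : ∀ {n} {B : Set} (h : B → ℕ) (f : Fin n → List.List B) →
  List.sum (List.map h (List.concatMap f (List.allFin n))) ≡ ∑[ x < n ] List.sum (List.map h (f x))
sum-concatMap-allFin {n} h f = trans (sum-concatMap (List.allFin n)) (sum-map-allFin λ x → List.sum (List.map h (f x)))
  where
  sum-concatMap : ∀ xs → List.sum (List.map h (List.concatMap f xs)) ≡ List.sum (List.map (λ x → List.sum (List.map h (f x))) xs)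
  sum-concatMap List.[] = refl
  sum-concatMap (x List.∷ xs) = trans (cong List.sum (List.map-++ h (f x) (List.concatMap f xs)))
    (trans (sum-++ (List.map h (f x)) _) (cong (List.sum (List.map h (f x)) +_) (sum-concatMap xs)))

∑³ : ∀ {n} → (Fin n → Fin n → Fin n → ℕ) → ℕ
∑³ {n} f = ∑[ i < n ] ∑[ j < n ] ∑[ k < n ] f i j k

module _ {n : ℕ} where

  ∑³-cong : {f g : Fin n → Fin n → Fin n → ℕ} → (∀ i j k → f i j k ≡ g i j k) → ∑³ f ≡ ∑³ g
  ∑³-cong f≡g = sum-cong-≗ λ i → sum-cong-≗ λ j → sum-cong-≗ λ k → f≡g i j k

  ∑³-mono-≤ : {f g : Fin n → Fin n → Fin n → ℕ} → (∀ i j k → f i j k ≤ g i j k) → ∑³ f ≤ ∑³ g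
  ∑³-mono-≤ f≤g = ∑-mono-≤ λ i → ∑-mono-≤ λ j → ∑-mono-≤ λ k → f≤g i j k

  term≤∑³ : (f : Fin n → Fin n → Fin n → ℕ) → ∀ i j k → f i j k ≤ ∑³ f
  term≤∑³ f i j k = ≤-trans (term≤∑ (f i j) k)
    (≤-trans (term≤∑ (λ j → sum (f i j)) j) (term≤∑ (λ i → ∑[ j < n ] sum (f i j)) i))

  ∑³-distrib-+ : (f g : Fin n → Fin n → Fin n → ℕ) → ∑³ (λ i j k → f i j k + g i j k) ≡ ∑³ f + ∑³ g
  ∑³-distrib-+ f g = trans
    (sum-cong-≗ λ i → trans (sum-cong-≗ λ j → ∑-distrib-+ (f i j) (g i j))
      (∑-distrib-+ (λ j → sum (f i j)) (λ j → sum (g i j))))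
    (∑-distrib-+ (λ i → ∑[ j < n ] sum (f i j)) (λ i → ∑[ j < n ] sum (g i j)))

  *-distribˡ-∑³ : ∀ c (f : Fin n → Fin n → Fin n → ℕ) → c * ∑³ f ≡ ∑³ (λ i j k → c * f i j k)
  *-distribˡ-∑³ c f = trans (*-distribˡ-sum c (λ i → ∑[ j < n ] sum (f i j)))
    (sum-cong-≗ λ i → trans (*-distribˡ-sum c (λ j → sum (f i j))) (sum-cong-≗ λ j → *-distribˡ-sum c (f i j)))

  ∑-∑³-comm : ∀ {m} (f : Fin m → Fin n → Fin n → Fin n → ℕ) →
    ∑[ x < m ] ∑³ (f x) ≡ ∑³ (λ i j k → ∑[ x < m ] f x i j k)
  ∑-∑³-comm f = trans (∑-comm λ x i → ∑[ j < n ] ∑[ k < n ] f x i j k)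
    (sum-cong-≗ λ i → trans (∑-comm λ x j → ∑[ k < n ] f x i j k)
      (sum-cong-≗ λ j → ∑-comm λ x k → f x i j k))

𝟙 : Bool → ℕ
𝟙 b = if b then 1 else 0

𝟙-∧ : ∀ a b → 𝟙 (a ∧ b) ≡ 𝟙 a * 𝟙 b
𝟙-∧ true b = sym (+-identityʳ (𝟙 b))
𝟙-∧ false b = refl

𝟙-∧-middle : ∀ a b c → 𝟙 (a ∧ (b ∧ c)) ≡ 𝟙 b * 𝟙 (a ∧ c)
𝟙-∧-middle a true c = sym (+-identityʳ _)
𝟙-∧-middle false false c = refl
𝟙-∧-middle true false c = refl

𝟙-not : ∀ b → 𝟙 b + 𝟙 (not b) ≡ 1
𝟙-not true = refl
𝟙-not false = refl

∧-true : ∀ {a b} → a ∧ b ≡ true → a ≡ true × b ≡ true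
∧-true {true} b≡true = refl , b≡true

≢true⇒≡false : ∀ {b} → b ≢ true → b ≡ false
≢true⇒≡false {false} _ = refl
≢true⇒≡false {true} b≢true = contradiction refl b≢true

true≢not-true : ∀ {a b} → a ≡ true → not b ≡ true → a ≢ b
true≢not-true {true} {false} _ _ ()

some-false : ∀ {p q r t} → (p ≡ true → q ≡ true → r ≡ true → t ≡ true → ⊥) →
  p ≡ false ⊎ q ≡ false ⊎ r ≡ false ⊎ t ≡ false
some-false {false} _ = inj₁ refl
some-false {true} {false} _ = inj₂ (inj₁ refl)
some-false {true} {true} {false} _ = inj₂ (inj₂ (inj₁ refl))
some-false {true} {true} {true} {false} _ = inj₂ (inj₂ (inj₂ refl))
some-false {true} {true} {true} {true} all-true = contradiction refl (all-true refl refl refl)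

∣_∣ : ∀ {n} → (Fin n → Bool) → ℕ
∣ S ∣ = sum λ x → 𝟙 (S x)

countTrue≡∣∣ : ∀ {n} (S : Fin n → Bool) → countTrue S ≡ ∣ S ∣
countTrue≡∣∣ S = sum-map-allFin λ x → 𝟙 (S x)

all : ∀ {n} → Fin n → Bool
all _ = true

∣all∣ : ∀ n → ∣ all {n} ∣ ≡ n
∣all∣ zero = refl
∣all∣ (suc n) = cong suc (∣all∣ n)

∣∣+∣not∣ : ∀ {n} (S : Fin n → Bool) → ∣ S ∣ + ∣ not ∘ S ∣ ≡ n
∣∣+∣not∣ {n} S = begin
  ∣ S ∣ + ∣ not ∘ S ∣                   ≡⟨ ∑-distrib-+ (λ x → 𝟙 (S x)) (λ x → 𝟙 (not (S x))) ⟨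
  ∑[ x < n ] (𝟙 (S x) + 𝟙 (not (S x)))  ≡⟨ sum-cong-≗ (𝟙-not ∘ S) ⟩
  ∣ all {n} ∣                           ≡⟨ ∣all∣ n ⟩
  n                                     ∎
  where open ≡-Reasoning

infixl 20 _─_

_─_ : ∀ {n} → (Fin n → Bool) → Fin n → Fin n → Bool
(S ─ x) y = S y ∧ not (does (y Finₚ.≟ x))

─-⊆ : ∀ {n} (S : Fin n → Bool) {x y} → (S ─ x) y ≡ true → S y ≡ true
─-⊆ S {x} {y} _ with S y
... | true = refl

─-≢ : ∀ {n} (S : Fin n → Bool) {x y} → (S ─ x) y ≡ true → y ≢ x
─-≢ S {x} {y} _ refl with S y | y Finₚ.≟ y
... | true | no y≢y = y≢y refl

─-∈ : ∀ {n} (S : Fin n → Bool) {x y} → S y ≡ true → y ≢ x → (S ─ x) y ≡ true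
─-∈ S {x} {y} Sy y≢x rewrite Sy | dec-false (y Finₚ.≟ x) y≢x = refl

does-≟-sym : ∀ {n} (x y : Fin n) → does (x Finₚ.≟ y) ≡ does (y Finₚ.≟ x)
does-≟-sym x y = does-⇔ (mk⇔ sym sym) (x Finₚ.≟ y) (y Finₚ.≟ x)

∣∣-─ : ∀ {n} (S : Fin n → Bool) x → ∣ S ∣ ≡ 𝟙 (S x) + ∣ S ─ x ∣
∣∣-─ S fzero = cong (𝟙 (S fzero) +_) (sym (cong₂ _+_
  (cong 𝟙 (∧-zeroʳ (S fzero))) (sum-cong-≗ λ y → cong 𝟙 (∧-identityʳ (S (fsuc y))))))
∣∣-─ S (fsuc x) = begin
  𝟙 (S fzero) + ∣ S ∘ fsuc ∣                           ≡⟨ cong (𝟙 (S fzero) +_) (∣∣-─ (S ∘ fsuc) x) ⟩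
  𝟙 (S fzero) + (𝟙 (S (fsuc x)) + ∣ (S ∘ fsuc) ─ x ∣)
    ≡⟨ x+[y+z]≡y+[x+z] (𝟙 (S fzero)) (𝟙 (S (fsuc x))) ∣ (S ∘ fsuc) ─ x ∣ ⟩
  𝟙 (S (fsuc x)) + (𝟙 (S fzero) + ∣ (S ∘ fsuc) ─ x ∣)
    ≡⟨ cong (λ b → 𝟙 (S (fsuc x)) + (𝟙 b + ∣ (S ∘ fsuc) ─ x ∣)) (∧-identityʳ (S fzero)) ⟨
  𝟙 (S (fsuc x)) + ∣ S ─ fsuc x ∣                      ∎
  where open ≡-Reasoning

∣∣-─-suc : ∀ {n} (S : Fin n → Bool) {x} → S x ≡ true → ∣ S ∣ ≡ suc ∣ S ─ x ∣
∣∣-─-suc S {x} Sx = trans (∣∣-─ S x) (cong (λ b → 𝟙 b + ∣ S ─ x ∣) Sx)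

pick : ∀ {n} (S : Fin n → Bool) → 0 < ∣ S ∣ → ∃ λ x → S x ≡ true
pick {suc n} S 0<∣S∣ with S fzero in S0
... | true = fzero , S0
... | false = let x , Sx = pick (S ∘ fsuc) 0<∣S∣ in fsuc x , Sx

distinct-elements : ∀ {n} k (T : Fin n → Bool) → k ≤ ∣ T ∣ →
  Σ (Vec (Fin n) k) λ vs → Unique vs × VecAll.All (λ x → T x ≡ true) vs
distinct-elements zero T _ = [] , [] , []
distinct-elements (suc k) T k<∣T∣ with pick T (≤-trans (s≤s z≤n) k<∣T∣)
... | x , Tx with distinct-elements k (T ─ x) (≤-pred (subst (suc k ≤_) (∣∣-─-suc T Tx) k<∣T∣))
... | vs , unique , in-T─x = x ∷ vs , VecAll.map (λ y∈T─x x≡y → ─-≢ T y∈T─x (sym x≡y)) in-T─x ∷ unique ,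
  Tx ∷ VecAll.map (─-⊆ T) in-T─x

ordered : ∀ {n} → Fin n → Fin n → Fin n → Bool
ordered i j k = (toℕ i <ᵇ toℕ j) ∧ (toℕ j <ᵇ toℕ k)

inside : ∀ {n} → (Fin n → Bool) → Fin n → Fin n → Fin n → Bool
inside S i j k = S i ∧ (S j ∧ S k)

#triples : ∀ {n} → (Fin n → Fin n → Fin n → Bool) → (Fin n → Bool) → ℕ
#triples w S = ∑³ λ i j k → 𝟙 (w i j k ∧ (ordered i j k ∧ inside S i j k))

<ᵇ⇒<ᶠ : ∀ {n} {i j : Fin n} → (toℕ i <ᵇ toℕ j) ≡ true → i Fin.< j
<ᵇ⇒<ᶠ {i = i} {j} e = <ᵇ⇒< (toℕ i) (toℕ j) (Equivalence.from T-≡ e)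

<ᶠ⇒<ᵇ : ∀ {n} {i j : Fin n} → i Fin.< j → (toℕ i <ᵇ toℕ j) ≡ true
<ᶠ⇒<ᵇ i<j = Equivalence.to T-≡ (<⇒<ᵇ i<j)

ordered-intro : ∀ {n} {i j k : Fin n} → i Fin.< j → j Fin.< k → ordered i j k ≡ true
ordered-intro i<j j<k = cong₂ _∧_ (<ᶠ⇒<ᵇ i<j) (<ᶠ⇒<ᵇ j<k)

ordered-distinct : ∀ {n} {i j k : Fin n} → ordered i j k ≡ true → Distinct3 i j k
ordered-distinct o with ∧-true o
... | i<j , j<k =
  Finₚ.<⇒≢ (<ᵇ⇒<ᶠ i<j) , Finₚ.<⇒≢ (<ᵇ⇒<ᶠ j<k) , Finₚ.<⇒≢ (Finₚ.<-trans (<ᵇ⇒<ᶠ i<j) (<ᵇ⇒<ᶠ j<k))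

ordered-inside : ∀ {n} (S : Fin n → Bool) {i j k} → ordered i j k ∧ inside S i j k ≡ true →
  ordered i j k ≡ true × S i ≡ true × S j ≡ true × S k ≡ true
ordered-inside S {i} {j} {k} t with ∧-true {ordered i j k} t
... | o , t′ with ∧-true {S i} t′
... | Si , t″ with ∧-true {S j} t″
... | Sj , Sk = o , Si , Sj , Sk

sum-triples : ∀ {n} (h : Fin n × Fin n × Fin n → ℕ) →
  List.sum (List.map h (triples n)) ≡ ∑³ λ i j k → 𝟙 (ordered i j k) * h (i , j , k)
sum-triples {n} h =
  trans (sum-concatMap-allFin h λ i → List.concatMap (λ j → List.concatMap (cell i j) (List.allFin n)) (List.allFin n))
  (sum-cong-≗ λ i → trans (sum-concatMap-allFin h λ j → List.concatMap (cell i j) (List.allFin n))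
  (sum-cong-≗ λ j → trans (sum-concatMap-allFin h (cell i j))
  (sum-cong-≗ λ k → sum-cell i j k)))
  where
  cell : Fin n → Fin n → Fin n → List.List (Fin n × Fin n × Fin n)
  cell i j k = if ordered i j k then (i , j , k) List.∷ List.[] else List.[]
  sum-cell : ∀ i j k → List.sum (List.map h (cell i j k)) ≡ 𝟙 (ordered i j k) * h (i , j , k)
  sum-cell i j k with ordered i j k
  ... | false = refl
  ... | true = refl

numEdges≡#triples : ∀ {n} (G : Graph3 n) → numEdges G ≡ #triples (edge G) all
numEdges≡#triples {n} G = trans (sum-triples {n} _) (∑³-cong λ i j k → begin
  𝟙 (ordered i j k) * 𝟙 (edge G i j k)         ≡⟨ *-comm (𝟙 (ordered i j k)) _ ⟩
  𝟙 (edge G i j k) * 𝟙 (ordered i j k)         ≡⟨ 𝟙-∧ (edge G i j k) (ordered i j k) ⟨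
  𝟙 (edge G i j k ∧ ordered i j k)             ≡⟨ cong (λ b → 𝟙 (edge G i j k ∧ b)) (∧-identityʳ (ordered i j k)) ⟨
  𝟙 (edge G i j k ∧ (ordered i j k ∧ true))    ∎)
  where open ≡-Reasoning

pascal-𝟙 : ∀ b c k → (𝟙 b + c) C suc k ≡ 𝟙 b * (c C k) + c C suc k
pascal-𝟙 false c k = refl
pascal-𝟙 true c k = trans (sym (nCk+nC[k+1]≡[n+1]C[k+1] c k)) (cong (_+ c C suc k) (sym (+-identityʳ _)))

#pairs : ∀ {n} → (Fin n → Bool) → ℕ
#pairs {n} S = ∑[ j < n ] ∑[ k < n ] 𝟙 ((toℕ j <ᵇ toℕ k) ∧ (S j ∧ S k))

#pairs≡C2 : ∀ {n} (S : Fin n → Bool) → #pairs S ≡ ∣ S ∣ C 2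
#pairs≡C2 {zero} S = refl
#pairs≡C2 {suc n} S = begin
  (∑[ k < n ] 𝟙 (S fzero ∧ S (fsuc k))) + #pairs (S ∘ fsuc)
    ≡⟨ cong₂ _+_ (sum-cong-≗ λ k → 𝟙-∧ (S fzero) (S (fsuc k))) (#pairs≡C2 (S ∘ fsuc)) ⟩
  (∑[ k < n ] (𝟙 (S fzero) * 𝟙 (S (fsuc k)))) + ∣ S ∘ fsuc ∣ C 2
    ≡⟨ cong (_+ ∣ S ∘ fsuc ∣ C 2) (*-distribˡ-sum (𝟙 (S fzero)) (λ k → 𝟙 (S (fsuc k)))) ⟨
  𝟙 (S fzero) * ∣ S ∘ fsuc ∣ + ∣ S ∘ fsuc ∣ C 2          ≡⟨ cong (λ c → 𝟙 (S fzero) * c + ∣ S ∘ fsuc ∣ C 2) (nC1≡n _) ⟨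
  𝟙 (S fzero) * (∣ S ∘ fsuc ∣ C 1) + ∣ S ∘ fsuc ∣ C 2    ≡⟨ pascal-𝟙 (S fzero) ∣ S ∘ fsuc ∣ 1 ⟨
  ∣ S ∣ C 2                                              ∎
  where open ≡-Reasoning

-- Split off the triples with smallest vertex 0, which are the pairs of S ∘ fsuc when S 0 holds.
#triples≡C3 : ∀ {n} (S : Fin n → Bool) → #triples (λ _ _ _ → true) S ≡ ∣ S ∣ C 3
#triples≡C3 {zero} S = refl
#triples≡C3 {suc n} S = begin
  first-vertex + rest                                        ≡⟨ cong₂ _+_ first-vertex≡ rest≡ ⟩
  𝟙 (S fzero) * #pairs S′ + #triples (λ _ _ _ → true) S′     ≡⟨ cong₂ (λ p t → 𝟙 (S fzero) * p + t) (#pairs≡C2 S′) (#triples≡C3 S′) ⟩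
  𝟙 (S fzero) * (∣ S′ ∣ C 2) + ∣ S′ ∣ C 3                    ≡⟨ pascal-𝟙 (S fzero) ∣ S′ ∣ 2 ⟨
  ∣ S ∣ C 3                                                  ∎
  where
  open ≡-Reasoning
  S′ : Fin n → Bool
  S′ = S ∘ fsuc
  first-vertex rest : ℕ
  first-vertex = ∑[ j < suc n ] ∑[ k < suc n ] 𝟙 (ordered fzero j k ∧ inside S fzero j k)
  rest = ∑[ i < n ] ∑[ j < suc n ] ∑[ k < suc n ] 𝟙 (ordered (fsuc i) j k ∧ inside S (fsuc i) j k)
  pair : Fin n → Fin n → ℕ
  pair j k = 𝟙 ((toℕ j <ᵇ toℕ k) ∧ (S′ j ∧ S′ k))
  first-vertex≡ : first-vertex ≡ 𝟙 (S fzero) * #pairs S′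
  first-vertex≡ = begin
    first-vertex
      ≡⟨ cong (_+ ∑[ j < n ] ∑[ k < suc n ] 𝟙 (ordered fzero (fsuc j) k ∧ inside S fzero (fsuc j) k)) (sum-replicate-zero (suc n)) ⟩
    ∑[ j < n ] ∑[ k < n ] 𝟙 ((toℕ j <ᵇ toℕ k) ∧ (S fzero ∧ (S′ j ∧ S′ k)))
      ≡⟨ sum-cong-≗ (λ j → sum-cong-≗ λ k → 𝟙-∧-middle (toℕ j <ᵇ toℕ k) (S fzero) (S′ j ∧ S′ k)) ⟩
    ∑[ j < n ] ∑[ k < n ] (𝟙 (S fzero) * pair j k)   ≡⟨ sum-cong-≗ (λ j → *-distribˡ-sum (𝟙 (S fzero)) (pair j)) ⟨
    ∑[ j < n ] (𝟙 (S fzero) * sum (pair j))          ≡⟨ *-distribˡ-sum (𝟙 (S fzero)) (sum ∘ pair) ⟨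
    𝟙 (S fzero) * #pairs S′                           ∎
  rest≡ : rest ≡ #triples (λ _ _ _ → true) S′
  rest≡ = sum-cong-≗ λ i → trans (cong (_+ from i) (sum-replicate-zero (suc n))) (sum-cong-≗ λ j →
    cong (_+ ∑[ k < n ] 𝟙 (ordered i j k ∧ inside S′ i j k))
      (cong (λ b → 𝟙 (b ∧ inside S (fsuc i) (fsuc j) fzero)) (∧-zeroʳ (toℕ i <ᵇ toℕ j))))
    where
    from : Fin n → ℕ
    from i = ∑[ j < n ] ∑[ k < suc n ] 𝟙 (ordered (fsuc i) (fsuc j) k ∧ inside S (fsuc i) (fsuc j) k)

numEdges+numEdges-compl : ∀ {n} (G : Graph3 n) → numEdges G + numEdges (compl G) ≡ n C 3
numEdges+numEdges-compl {n} G = begin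
  numEdges G + numEdges (compl G)                    ≡⟨ cong₂ _+_ (numEdges≡#triples G) (numEdges≡#triples (compl G)) ⟩
  #triples (edge G) all + #triples (edge (compl G)) all
    ≡⟨ ∑³-distrib-+ (λ i j k → 𝟙 (edge G i j k ∧ (ordered i j k ∧ true))) (λ i j k → 𝟙 (not (edge G i j k) ∧ (ordered i j k ∧ true))) ⟨
  ∑³ (λ i j k → 𝟙 (edge G i j k ∧ (ordered i j k ∧ true)) + 𝟙 (not (edge G i j k) ∧ (ordered i j k ∧ true)))
    ≡⟨ ∑³-cong (λ i j k → 𝟙-split (edge G i j k) (ordered i j k ∧ true)) ⟩
  #triples (λ _ _ _ → true) (all {n})                ≡⟨ #triples≡C3 (all {n}) ⟩
  ∣ all {n} ∣ C 3                                    ≡⟨ cong (_C 3) (∣all∣ n) ⟩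
  n C 3                                              ∎
  where
  open ≡-Reasoning
  𝟙-split : ∀ e t → 𝟙 (e ∧ t) + 𝟙 (not e ∧ t) ≡ 𝟙 t
  𝟙-split true t = +-identityʳ (𝟙 t)
  𝟙-split false t = refl

#triples≤numEdges : ∀ {n} (G : Graph3 n) S → #triples (edge G) S ≤ numEdges G
#triples≤numEdges G S = subst (#triples (edge G) S ≤_) (sym (numEdges≡#triples G))
  (∑³-mono-≤ λ i j k → pointwise (edge G i j k) (ordered i j k) (inside S i j k))
  where
  pointwise : ∀ e o t → 𝟙 (e ∧ (o ∧ t)) ≤ 𝟙 (e ∧ (o ∧ true))
  pointwise false _ _ = z≤n
  pointwise true false _ = z≤n
  pointwise true true false = z≤n
  pointwise true true true = ≤-refl

𝟙-monochromatic : ∀ x y z {g} → (g ≡ true ⇔ (x ≡ y × y ≡ z)) →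
  𝟙 g ≡ 𝟙 (x ∧ (y ∧ z)) + 𝟙 (not x ∧ (not y ∧ not z))
𝟙-monochromatic true true true g⇔ = cong 𝟙 (Equivalence.from g⇔ (refl , refl))
𝟙-monochromatic false false false g⇔ = cong 𝟙 (Equivalence.from g⇔ (refl , refl))
𝟙-monochromatic true true false g⇔ = cong 𝟙 (≢true⇒≡false λ g → case Equivalence.to g⇔ g of λ ())
𝟙-monochromatic true false _ g⇔ = cong 𝟙 (≢true⇒≡false λ g → case Equivalence.to g⇔ g of λ ())
𝟙-monochromatic false true _ g⇔ = cong 𝟙 (≢true⇒≡false λ g → case Equivalence.to g⇔ g of λ ())
𝟙-monochromatic false false true g⇔ = cong 𝟙 (≢true⇒≡false λ g → case Equivalence.to g⇔ g of λ ())

numEdges-two-cliques : ∀ {n} (G : Graph3 n) (s : Fin n → Bool) →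
  (∀ a b c → Distinct3 a b c → (edge G a b c ≡ true) ⇔ (s a ≡ s b × s b ≡ s c)) →
  numEdges G ≡ ∣ s ∣ C 3 + ∣ not ∘ s ∣ C 3
numEdges-two-cliques G s cliques = begin
  numEdges G                                                      ≡⟨ numEdges≡#triples G ⟩
  #triples (edge G) all                                           ≡⟨ ∑³-cong pointwise ⟩
  ∑³ (λ i j k → 𝟙 (ordered i j k ∧ inside s i j k) + 𝟙 (ordered i j k ∧ inside (not ∘ s) i j k))
    ≡⟨ ∑³-distrib-+ (λ i j k → 𝟙 (ordered i j k ∧ inside s i j k)) (λ i j k → 𝟙 (ordered i j k ∧ inside (not ∘ s) i j k)) ⟩
  #triples (λ _ _ _ → true) s + #triples (λ _ _ _ → true) (not ∘ s)  ≡⟨ cong₂ _+_ (#triples≡C3 s) (#triples≡C3 (not ∘ s)) ⟩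
  ∣ s ∣ C 3 + ∣ not ∘ s ∣ C 3                                     ∎
  where
  open ≡-Reasoning
  pointwise : ∀ i j k → 𝟙 (edge G i j k ∧ (ordered i j k ∧ true)) ≡
    𝟙 (ordered i j k ∧ inside s i j k) + 𝟙 (ordered i j k ∧ inside (not ∘ s) i j k)
  pointwise i j k with ordered i j k in o
  ... | false = cong 𝟙 (∧-zeroʳ (edge G i j k))
  ... | true = trans (cong 𝟙 (∧-identityʳ (edge G i j k)))
    (𝟙-monochromatic (s i) (s j) (s k) (cliques i j k (ordered-distinct o)))

numEdges-DisjUnionCliques : ∀ {n} (G : Graph3 n) {p q} → DisjUnionCliques G p q → numEdges G ≡ p C 3 + q C 3
numEdges-DisjUnionCliques G (s , ∣s∣≡p , ∣not∘s∣≡q , cliques) = trans (numEdges-two-cliques G s cliques)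
  (cong₂ (λ a b → a C 3 + b C 3) (trans (sym (countTrue≡∣∣ s)) ∣s∣≡p)
    (trans (sym (countTrue≡∣∣ (not ∘ s))) ∣not∘s∣≡q))

≢⇒<⊎> : ∀ {n} {a b : Fin n} → a ≢ b → a Fin.< b ⊎ b Fin.< a
≢⇒<⊎> {a = a} {b} a≢b with Finₚ.<-cmp a b
... | tri< a<b _ _ = inj₁ a<b
... | tri≈ _ a≡b _ = contradiction a≡b a≢b
... | tri> _ _ b<a = inj₂ b<a

module _ {n} {W : Fin n → Fin n → Fin n → Set}
  (swap₁₂ : ∀ {a b c} → W a b c → W b a c) (swap₂₃ : ∀ {a b c} → W a b c → W a c b) where

  sort-triple : ∀ {a b c} → Distinct3 a b c → ∃[ i ] ∃[ j ] ∃[ k ] ordered i j k ≡ true × (W a b c ⇔ W i j k)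
  sort-triple (a≢b , b≢c , a≢c) with ≢⇒<⊎> a≢b | ≢⇒<⊎> b≢c | ≢⇒<⊎> a≢c
  ... | inj₁ a<b | inj₁ b<c | _       = _ , _ , _ , ordered-intro a<b b<c , mk⇔ id id
  ... | inj₁ a<b | inj₂ c<b | inj₁ a<c = _ , _ , _ , ordered-intro a<c c<b , mk⇔ swap₂₃ swap₂₃
  ... | inj₁ a<b | inj₂ c<b | inj₂ c<a = _ , _ , _ , ordered-intro c<a a<b ,
    mk⇔ (swap₁₂ ∘ swap₂₃) (swap₂₃ ∘ swap₁₂)
  ... | inj₂ b<a | inj₁ b<c | inj₁ a<c = _ , _ , _ , ordered-intro b<a a<c , mk⇔ swap₁₂ swap₁₂
  ... | inj₂ b<a | inj₁ b<c | inj₂ c<a = _ , _ , _ , ordered-intro b<c c<a ,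
    mk⇔ (swap₂₃ ∘ swap₁₂) (swap₁₂ ∘ swap₂₃)
  ... | inj₂ b<a | inj₂ c<b | _       = _ , _ , _ , ordered-intro c<b b<a ,
    mk⇔ (swap₁₂ ∘ swap₂₃ ∘ swap₁₂) (swap₁₂ ∘ swap₂₃ ∘ swap₁₂)

  ordered⇒distinct : (∀ i j k → ordered i j k ≡ true → W i j k) → ∀ a b c → Distinct3 a b c → W a b c
  ordered⇒distinct W-ordered a b c abc with sort-triple abc
  ... | i , j , k , o , Wabc⇔Wijk = Equivalence.from Wabc⇔Wijk (W-ordered i j k o)

edge-counted : ∀ {n} (G : Graph3 n) (S : Fin n → Bool) {a b c} → IsEdge G a b c →
  S a ≡ true → S b ≡ true → S c ≡ true → 0 < #triples (edge G) S
edge-counted {n} G S (abc , e) Sa Sb Sc with sort-triple {W = W} swap₁₂ swap₂₃ abc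
  where
  W : Fin n → Fin n → Fin n → Set
  W a b c = edge G a b c ≡ true × S a ≡ true × S b ≡ true × S c ≡ true
  swap₁₂ : ∀ {a b c} → W a b c → W b a c
  swap₁₂ {a} {b} {c} (e , Sa , Sb , Sc) = trans (sym (sym₁₂ G a b c)) e , Sb , Sa , Sc
  swap₂₃ : ∀ {a b c} → W a b c → W a c b
  swap₂₃ {a} {b} {c} (e , Sa , Sb , Sc) = trans (sym (sym₂₃ G a b c)) e , Sa , Sc , Sb
... | i , j , k , o , Wabc⇔Wijk with Equivalence.to Wabc⇔Wijk (e , Sa , Sb , Sc)
... | eᵢⱼₖ , Si , Sj , Sk = subst (_≤ #triples (edge G) S) counted
  (term≤∑³ (λ i j k → 𝟙 (edge G i j k ∧ (ordered i j k ∧ inside S i j k))) i j k)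
  where
  counted : 𝟙 (edge G i j k ∧ (ordered i j k ∧ inside S i j k)) ≡ 1
  counted rewrite eᵢⱼₖ | o | Si | Sj | Sk = refl

∈-triples : ∀ {n} {i j k : Fin n} → ordered i j k ≡ true → (i , j , k) ∈ triples n
∈-triples {i = i} {j} {k} o = ∈-concatMap⁺ _ (lose (∈-allFin i) (∈-concatMap⁺ _ (lose (∈-allFin j)
  (∈-concatMap⁺ _ (lose (∈-allFin k)
    (subst (λ b → (i , j , k) ∈ (if b then (i , j , k) List.∷ List.[] else List.[])) (sym o) (here refl)))))))

2*C2 : ∀ k → 2 * (suc k C 2) ≡ suc k * k
2*C2 zero = refl
2*C2 (suc k) = begin
  2 * (suc (suc k) C 2)          ≡⟨ cong (2 *_) (nCk+nC[k+1]≡[n+1]C[k+1] (suc k) 1) ⟨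
  2 * (suc k C 1 + suc k C 2)    ≡⟨ cong (λ c → 2 * (c + suc k C 2)) (nC1≡n (suc k)) ⟩
  2 * (suc k + suc k C 2)        ≡⟨ *-distribˡ-+ 2 (suc k) _ ⟩
  2 * suc k + 2 * (suc k C 2)    ≡⟨ cong (2 * suc k +_) (2*C2 k) ⟩
  2 * suc k + suc k * k          ≡⟨ poly k ⟩
  suc (suc k) * suc k            ∎
  where
  open ≡-Reasoning
  poly : ∀ k → 2 * suc k + suc k * k ≡ suc (suc k) * suc k
  poly = solve-∀

6*C3 : ∀ k → 6 * ((2 + k) C 3) ≡ (2 + k) * (1 + k) * k
6*C3 zero = refl
6*C3 (suc k) = begin
  6 * ((3 + k) C 3)                                ≡⟨ cong (6 *_) (nCk+nC[k+1]≡[n+1]C[k+1] (2 + k) 2) ⟨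
  6 * ((2 + k) C 2 + (2 + k) C 3)                  ≡⟨ *-distribˡ-+ 6 ((2 + k) C 2) _ ⟩
  6 * ((2 + k) C 2) + 6 * ((2 + k) C 3)            ≡⟨ cong (_+ 6 * ((2 + k) C 3)) (*-assoc 3 2 ((2 + k) C 2)) ⟩
  3 * (2 * ((2 + k) C 2)) + 6 * ((2 + k) C 3)      ≡⟨ cong₂ (λ a b → 3 * a + b) (2*C2 (suc k)) (6*C3 k) ⟩
  3 * ((2 + k) * (1 + k)) + (2 + k) * (1 + k) * k  ≡⟨ poly k ⟩
  (3 + k) * (2 + k) * (1 + k)                      ∎
  where
  open ≡-Reasoning
  poly : ∀ k → 3 * ((2 + k) * (1 + k)) + (2 + k) * (1 + k) * k ≡ (3 + k) * (2 + k) * (1 + k)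
  poly = solve-∀

C3-shift : ∀ k → (3 + k) * ((2 + k) C 3) ≡ k * ((3 + k) C 3)
C3-shift k = *-cancelˡ-≡ _ _ 6 (begin
  6 * ((3 + k) * ((2 + k) C 3))      ≡⟨ x*[y*z]≡y*[x*z] 6 (3 + k) ((2 + k) C 3) ⟩
  (3 + k) * (6 * ((2 + k) C 3))      ≡⟨ cong ((3 + k) *_) (6*C3 k) ⟩
  (3 + k) * ((2 + k) * (1 + k) * k)  ≡⟨ poly k ⟩
  k * ((3 + k) * (2 + k) * (1 + k))  ≡⟨ cong (k *_) (6*C3 (suc k)) ⟨
  k * (6 * ((3 + k) C 3))            ≡⟨ x*[y*z]≡y*[x*z] k 6 ((3 + k) C 3) ⟩
  6 * (k * ((3 + k) C 3))            ∎)
  where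
  open ≡-Reasoning
  poly : ∀ k → (3 + k) * ((2 + k) * (1 + k) * k) ≡ k * ((3 + k) * (2 + k) * (1 + k))
  poly = solve-∀

-- Density of a family meeting every 4-set

-- A triple of S survives the deletion of x ∈ S exactly when x lies outside it.
deletion-pointwise : ∀ {n} (S : Fin n → Bool) i j k →
  ∑[ x < n ] (𝟙 (S x) * 𝟙 (ordered i j k ∧ inside (S ─ x) i j k)) + 3 * 𝟙 (ordered i j k ∧ inside S i j k)
    ≡ ∣ S ∣ * 𝟙 (ordered i j k ∧ inside S i j k)
deletion-pointwise {n} S i j k with ordered i j k ∧ inside S i j k in t
... | false = begin
  ∑[ x < n ] (𝟙 (S x) * 𝟙 (ordered i j k ∧ inside (S ─ x) i j k)) + 0
    ≡⟨ +-identityʳ _ ⟩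
  ∑[ x < n ] (𝟙 (S x) * 𝟙 (ordered i j k ∧ inside (S ─ x) i j k))
    ≡⟨ sum-cong-≗ (λ x → cong (λ b → 𝟙 (S x) * 𝟙 b) (absent x t)) ⟩
  ∑[ x < n ] (𝟙 (S x) * 0)   ≡⟨ sum-cong-≗ (λ x → *-zeroʳ (𝟙 (S x))) ⟩
  ∑[ x < n ] 0               ≡⟨ sum-replicate-zero n ⟩
  0                          ≡⟨ *-zeroʳ ∣ S ∣ ⟨
  ∣ S ∣ * 0                  ∎
  where
  open ≡-Reasoning
  absent : ∀ x → ordered i j k ∧ inside S i j k ≡ false → ordered i j k ∧ inside (S ─ x) i j k ≡ false
  absent x _ with ordered i j k | S i | S j | S k
  absent x _ | false | _ | _ | _ = refl
  absent x _ | true | false | _ | _ = refl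
  absent x _ | true | true | false | _ = ∧-zeroʳ _
  absent x _ | true | true | true | false = trans (cong (not (does (i Finₚ.≟ x)) ∧_) (∧-zeroʳ _)) (∧-zeroʳ _)
  absent x () | true | true | true | true
... | true with ordered-inside S t
... | o , Si , Sj , Sk = begin
  ∑[ x < n ] (𝟙 (S x) * 𝟙 (ordered i j k ∧ inside (S ─ x) i j k)) + 3 * 1  ≡⟨ cong (_+ 3) (sum-cong-≗ survivor) ⟩
  ∣ S ─ i ─ j ─ k ∣ + 3      ≡⟨ +-comm ∣ S ─ i ─ j ─ k ∣ 3 ⟩
  3 + ∣ S ─ i ─ j ─ k ∣      ≡⟨ remove-three ⟨
  ∣ S ∣                      ≡⟨ *-identityʳ ∣ S ∣ ⟨
  ∣ S ∣ * 1                  ∎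
  where
  open ≡-Reasoning
  i≢j : i ≢ j
  i≢j = proj₁ (ordered-distinct {i = i} {j} {k} o)
  j≢k : j ≢ k
  j≢k = proj₁ (proj₂ (ordered-distinct {i = i} {j} {k} o))
  i≢k : i ≢ k
  i≢k = proj₂ (proj₂ (ordered-distinct {i = i} {j} {k} o))
  remove-three : ∣ S ∣ ≡ 3 + ∣ S ─ i ─ j ─ k ∣
  remove-three = trans (∣∣-─-suc S Si) (cong suc (trans (∣∣-─-suc (S ─ i) (─-∈ S Sj (i≢j ∘ sym)))
    (cong suc (∣∣-─-suc (S ─ i ─ j) (─-∈ (S ─ i) (─-∈ S Sk (i≢k ∘ sym)) (j≢k ∘ sym))))))
  survivor : ∀ x → 𝟙 (S x) * 𝟙 (ordered i j k ∧ inside (S ─ x) i j k) ≡ 𝟙 ((S ─ i ─ j ─ k) x)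
  survivor x rewrite o | Si | Sj | Sk | does-≟-sym x i | does-≟-sym x j | does-≟-sym x k with S x
  ... | true = trans (+-identityʳ _) (cong 𝟙 (sym (∧-assoc (not (does (i Finₚ.≟ x))) _ _)))
  ... | false = refl

deletion-identity : ∀ {n} (w : Fin n → Fin n → Fin n → Bool) (S : Fin n → Bool) →
  ∑[ x < n ] (𝟙 (S x) * #triples w (S ─ x)) + 3 * #triples w S ≡ ∣ S ∣ * #triples w S
deletion-identity {n} w S = begin
  ∑[ x < n ] (𝟙 (S x) * #triples w (S ─ x)) + 3 * #triples w S
    ≡⟨ cong₂ _+_
         (trans (sum-cong-≗ λ x → *-distribˡ-∑³ (𝟙 (S x)) (f (S ─ x))) (∑-∑³-comm λ x i j k → 𝟙 (S x) * f (S ─ x) i j k))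
         (*-distribˡ-∑³ 3 (f S)) ⟩
  ∑³ (λ i j k → ∑[ x < n ] (𝟙 (S x) * f (S ─ x) i j k)) + ∑³ (λ i j k → 3 * f S i j k)
    ≡⟨ ∑³-distrib-+ (λ i j k → ∑[ x < n ] (𝟙 (S x) * f (S ─ x) i j k)) (λ i j k → 3 * f S i j k) ⟨
  ∑³ (λ i j k → ∑[ x < n ] (𝟙 (S x) * f (S ─ x) i j k) + 3 * f S i j k)
    ≡⟨ ∑³-cong pointwise ⟩
  ∑³ (λ i j k → ∣ S ∣ * f S i j k)
    ≡⟨ *-distribˡ-∑³ ∣ S ∣ (f S) ⟨
  ∣ S ∣ * #triples w S ∎
  where
  open ≡-Reasoning
  f : (Fin n → Bool) → Fin n → Fin n → Fin n → ℕ
  f T i j k = 𝟙 (w i j k ∧ (ordered i j k ∧ inside T i j k))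
  pointwise : ∀ i j k → ∑[ x < n ] (𝟙 (S x) * f (S ─ x) i j k) + 3 * f S i j k ≡ ∣ S ∣ * f S i j k
  pointwise i j k with w i j k
  ... | true = deletion-pointwise S i j k
  ... | false = trans (+-identityʳ _)
    (trans (sum-cong-≗ λ x → *-zeroʳ (𝟙 (S x))) (trans (sum-replicate-zero n) (sym (*-zeroʳ ∣ S ∣))))

averaging : ∀ {n} (S : Fin n → Bool) (f : Fin n → ℕ) B → (∀ x → S x ≡ true → B ≤ f x) →
  ∣ S ∣ * B ≤ ∑[ x < n ] (𝟙 (S x) * f x)
averaging {n} S f B B≤f = begin
  ∣ S ∣ * B                   ≡⟨ *-distribʳ-sum B (λ x → 𝟙 (S x)) ⟩
  ∑[ x < n ] (𝟙 (S x) * B)    ≤⟨ ∑-mono-≤ pointwise ⟩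
  ∑[ x < n ] (𝟙 (S x) * f x)  ∎
  where
  open ≤-Reasoning
  pointwise : ∀ x → 𝟙 (S x) * B ≤ 𝟙 (S x) * f x
  pointwise x with S x in Sx
  ... | true = +-monoˡ-≤ 0 (B≤f x Sx)
  ... | false = z≤n

Covers : ∀ {n} → Graph3 n → (Fin n → Bool) → Set
Covers {n} G S = ∀ (T : Fin n → Bool) → (∀ x → T x ≡ true → S x ≡ true) → ∣ T ∣ ≡ 4 → 0 < #triples (edge G) T

Covers-─ : ∀ {n} (G : Graph3 n) S x → Covers G S → Covers G (S ─ x)
Covers-─ G S x covers T T⊆S─x = covers T λ y Ty → ─-⊆ S (T⊆S─x y Ty)

module _ {n} (G : Graph3 n) where

  private
    T : (Fin n → Bool) → ℕ
    T = #triples (edge G)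

    ∣─∣ : ∀ (S : Fin n → Bool) {k} x → ∣ S ∣ ≡ suc k → S x ≡ true → ∣ S ─ x ∣ ≡ k
    ∣─∣ S x ∣S∣≡ Sx = suc-injective (trans (sym (∣∣-─-suc S {x} Sx)) ∣S∣≡)

  -- Base: each of the five 4-subsets of S contains an edge and each edge lies in two of them.
  -- Step: average over the deletions S ─ x, using (n + 1) C(n, 3) = (n − 2) C(n + 1, 3).
  covering-density : ∀ v (S : Fin n → Bool) → ∣ S ∣ ≡ 5 + v → Covers G S → 3 * ((5 + v) C 3) ≤ 10 * #triples (edge G) S
  covering-density zero S ∣S∣≡5 covers = *-monoʳ-≤ 10 (*-cancelˡ-< 2 2 (T S) (+-cancelʳ-≤ (3 * T S) 5 (2 * T S) (begin
    5 + 3 * T S              ≡⟨ cong (_+ 3 * T S) (*-identityʳ 5) ⟨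
    5 * 1 + 3 * T S          ≡⟨ cong (λ s → s * 1 + 3 * T S) ∣S∣≡5 ⟨
    ∣ S ∣ * 1 + 3 * T S      ≤⟨ +-monoˡ-≤ (3 * T S) (averaging S (T ∘ (S ─_)) 1 λ x Sx →
                                  covers (S ─ x) (λ y → ─-⊆ S {x} {y}) (∣─∣ S x ∣S∣≡5 Sx)) ⟩
    ∑[ x < n ] (𝟙 (S x) * T (S ─ x)) + 3 * T S  ≡⟨ deletion-identity (edge G) S ⟩
    ∣ S ∣ * T S              ≡⟨ cong (_* T S) ∣S∣≡5 ⟩
    5 * T S                  ≡⟨ *-distribʳ-+ (T S) 2 3 ⟩
    2 * T S + 3 * T S        ∎)))
    where open ≤-Reasoning
  covering-density (suc v) S ∣S∣≡6+v covers = *-cancelˡ-≤ (3 + v) (begin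
    (3 + v) * (3 * ((6 + v) C 3))    ≡⟨ x*[y*z]≡y*[x*z] (3 + v) 3 ((6 + v) C 3) ⟩
    3 * ((3 + v) * ((6 + v) C 3))    ≡⟨ cong (3 *_) (C3-shift (3 + v)) ⟨
    3 * ((6 + v) * ((5 + v) C 3))    ≡⟨ x*[y*z]≡y*[x*z] 3 (6 + v) ((5 + v) C 3) ⟩
    (6 + v) * (3 * ((5 + v) C 3))    ≡⟨ cong (_* (3 * ((5 + v) C 3))) ∣S∣≡6+v ⟨
    ∣ S ∣ * (3 * ((5 + v) C 3))      ≤⟨ averaging S (λ x → 10 * T (S ─ x)) (3 * ((5 + v) C 3)) (λ x Sx →
                                          covering-density v (S ─ x) (∣─∣ S x ∣S∣≡6+v Sx) (Covers-─ G S x covers)) ⟩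
    ∑[ x < n ] (𝟙 (S x) * (10 * T (S ─ x)))  ≡⟨ sum-cong-≗ (λ x → x*[y*z]≡y*[x*z] (𝟙 (S x)) 10 (T (S ─ x))) ⟩
    ∑[ x < n ] (10 * (𝟙 (S x) * T (S ─ x)))  ≡⟨ *-distribˡ-sum 10 (λ x → 𝟙 (S x) * T (S ─ x)) ⟨
    10 * ∑[ x < n ] (𝟙 (S x) * T (S ─ x))    ≡⟨ cong (10 *_) deleted ⟩
    10 * ((3 + v) * T S)             ≡⟨ x*[y*z]≡y*[x*z] 10 (3 + v) (T S) ⟩
    (3 + v) * (10 * T S)             ∎)
    where
    open ≤-Reasoning
    6+v≡3+v+3 : ∀ v t → (6 + v) * t ≡ (3 + v) * t + 3 * t
    6+v≡3+v+3 = solve-∀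
    deleted : ∑[ x < n ] (𝟙 (S x) * T (S ─ x)) ≡ (3 + v) * T S
    deleted = +-cancelʳ-≡ (3 * T S) _ _ (begin-equality
      ∑[ x < n ] (𝟙 (S x) * T (S ─ x)) + 3 * T S  ≡⟨ deletion-identity (edge G) S ⟩
      ∣ S ∣ * T S                    ≡⟨ cong (_* T S) ∣S∣≡6+v ⟩
      (6 + v) * T S                  ≡⟨ 6+v≡3+v+3 v (T S) ⟩
      (3 + v) * T S + 3 * T S        ∎)

-- K₅-freeness against a splitting colouring

EdgeAt : ∀ {n} → Graph3 n → Vec (Fin n) 5 → Fin 5 × Fin 5 × Fin 5 → Set
EdgeAt H vs (i , j , k) = edge H (lookup vs i) (lookup vs j) (lookup vs k) ≡ true

K5Free⇒¬K5-on : ∀ {n} (H : Graph3 n) → K5Free H → (vs : Vec (Fin n) 5) → Unique vs → All (EdgeAt H vs) (triples 5) → ⊥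
K5Free⇒¬K5-on H K5-free vs unique edges = K5-free (lookup vs , (λ {i} {j} → lookup-injective unique i j) ,
  ordered⇒distinct {W = λ i j k → EdgeAt H vs (i , j , k)}
    (λ e → trans (sym (sym₁₂ H _ _ _)) e) (λ e → trans (sym (sym₂₃ H _ _ _)) e)
    (λ i j k o → All.lookup edges (∈-triples o)))

Splits : ∀ {n} → Graph3 n → (Fin n → Bool) → Set
Splits G s = ∀ a b c → Distinct3 a b c → edge G a b c ≡ true → s a ≡ s b × s b ≡ s c

module _ {n} (H : Graph3 n) (K5-free : K5Free H) (s : Fin n → Bool) (splits : Splits (compl H) s) where

  private
    colour-≢ : ∀ {a b} → s a ≢ s b → a ≢ b
    colour-≢ sa≢sb a≡b = sa≢sb (cong s a≡b)

    crossing-edge : ∀ {a b c} → Distinct3 a b c → ¬ (s a ≡ s b × s b ≡ s c) → edge H a b c ≡ true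
    crossing-edge {a} {b} {c} abc not-mono with edge H a b c in e
    ... | true = refl
    ... | false = contradiction (splits a b c abc (cong not e)) not-mono

    crossing-first : ∀ {a b c} → s a ≢ s b → s a ≢ s c → b ≢ c → edge H a b c ≡ true
    crossing-first a≁b a≁c b≢c = crossing-edge (colour-≢ a≁b , b≢c , colour-≢ a≁c) (a≁b ∘ proj₁)

    crossing-last : ∀ {a b c} → a ≢ b → s a ≢ s c → s b ≢ s c → edge H a b c ≡ true
    crossing-last a≢b a≁c b≁c = crossing-edge (a≢b , colour-≢ b≁c , colour-≢ a≁c) (b≁c ∘ proj₂)

  -- Otherwise x, y, z, p, q span a K₅.
  monochromatic-nonedge : ∀ {x y z p q} → Distinct3 x y z → s x ≡ s y → s y ≡ s z →
    p ≢ q → s x ≢ s p → s x ≢ s q → edge H x y z ≡ false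
  monochromatic-nonedge {x} {y} {z} {p} {q} (x≢y , y≢z , x≢z) sx≡sy sy≡sz p≢q x≁p x≁q with edge H x y z in e
  ... | false = refl
  ... | true = contradiction
    ((x≢y ∷ x≢z ∷ colour-≢ x≁p ∷ colour-≢ x≁q ∷ []) ∷ (y≢z ∷ colour-≢ y≁p ∷ colour-≢ y≁q ∷ [])
      ∷ (colour-≢ z≁p ∷ colour-≢ z≁q ∷ []) ∷ (p≢q ∷ []) ∷ [] ∷ [])
    λ unique → K5Free⇒¬K5-on H K5-free (x ∷ y ∷ z ∷ p ∷ q ∷ []) unique
      (e ∷ crossing-last x≢y x≁p y≁p ∷ crossing-last x≢y x≁q y≁q ∷ crossing-last x≢z x≁p z≁p
        ∷ crossing-last x≢z x≁q z≁q ∷ crossing-first x≁p x≁q p≢q ∷ crossing-last y≢z y≁p z≁p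
        ∷ crossing-last y≢z y≁q z≁q ∷ crossing-first y≁p y≁q p≢q ∷ crossing-first z≁p z≁q p≢q ∷ [])
    where
    y≁p : s y ≢ s p
    y≁p = x≁p ∘ trans sx≡sy
    y≁q : s y ≢ s q
    y≁q = x≁q ∘ trans sx≡sy
    z≁p : s z ≢ s p
    z≁p = y≁p ∘ trans sy≡sz
    z≁q : s z ≢ s q
    z≁q = y≁q ∘ trans sy≡sz

  opposite-K4-free : ∀ {x₀ a b c d} → s x₀ ≢ s a → s x₀ ≢ s b → s x₀ ≢ s c → s x₀ ≢ s d →
    a ≢ b → a ≢ c → a ≢ d → b ≢ c → b ≢ d → c ≢ d →
    edge H a b c ≡ true → edge H a b d ≡ true → edge H a c d ≡ true → edge H b c d ≡ true → ⊥
  opposite-K4-free {x₀} {a} {b} {c} {d} x₀≁a x₀≁b x₀≁c x₀≁d a≢b a≢c a≢d b≢c b≢d c≢d abc abd acd bcd =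
    K5Free⇒¬K5-on H K5-free (x₀ ∷ a ∷ b ∷ c ∷ d ∷ [])
      ((colour-≢ x₀≁a ∷ colour-≢ x₀≁b ∷ colour-≢ x₀≁c ∷ colour-≢ x₀≁d ∷ [])
        ∷ (a≢b ∷ a≢c ∷ a≢d ∷ []) ∷ (b≢c ∷ b≢d ∷ []) ∷ (c≢d ∷ []) ∷ [] ∷ [])
      (crossing-first x₀≁a x₀≁b a≢b ∷ crossing-first x₀≁a x₀≁c a≢c ∷ crossing-first x₀≁a x₀≁d a≢d
        ∷ crossing-first x₀≁b x₀≁c b≢c ∷ crossing-first x₀≁b x₀≁d b≢d ∷ crossing-first x₀≁c x₀≁d c≢d
        ∷ abc ∷ abd ∷ acd ∷ bcd ∷ [])

  complement-covers-opposite-side : ∀ {x₀} → s x₀ ≡ true → Covers (compl H) (not ∘ s)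
  complement-covers-opposite-side {x₀} sx₀ T T⊆opposite ∣T∣≡4 = four-vertices (distinct-elements 4 T (≤-reflexive (sym ∣T∣≡4)))
    where
    x₀≁ : ∀ {y} → T y ≡ true → s x₀ ≢ s y
    x₀≁ {y} Ty = true≢not-true sx₀ (T⊆opposite y Ty)
    four-vertices : Σ (Vec (Fin n) 4) (λ vs → Unique vs × VecAll.All (λ x → T x ≡ true) vs) → 0 < #triples (edge (compl H)) T
    four-vertices (a ∷ b ∷ c ∷ d ∷ [] , (a≢b ∷ a≢c ∷ a≢d ∷ []) ∷ (b≢c ∷ b≢d ∷ []) ∷ (c≢d ∷ []) ∷ [] ∷ [] ,
                   Ta ∷ Tb ∷ Tc ∷ Td ∷ []) =
      counted (some-false (opposite-K4-free (x₀≁ Ta) (x₀≁ Tb) (x₀≁ Tc) (x₀≁ Td) a≢b a≢c a≢d b≢c b≢d c≢d))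
      where
      counted : edge H a b c ≡ false ⊎ edge H a b d ≡ false ⊎ edge H a c d ≡ false ⊎ edge H b c d ≡ false →
        0 < #triples (edge (compl H)) T
      counted (inj₁ abc) = edge-counted (compl H) T ((a≢b , b≢c , a≢c) , cong not abc) Ta Tb Tc
      counted (inj₂ (inj₁ abd)) = edge-counted (compl H) T ((a≢b , b≢d , a≢d) , cong not abd) Ta Tb Td
      counted (inj₂ (inj₂ (inj₁ acd))) = edge-counted (compl H) T ((a≢c , c≢d , a≢d) , cong not acd) Ta Tc Td
      counted (inj₂ (inj₂ (inj₂ bcd))) = edge-counted (compl H) T ((b≢c , c≢d , b≢d) , cong not bcd) Tb Tc Td

  complement-is-two-cliques : 2 ≤ ∣ s ∣ → 2 ≤ ∣ not ∘ s ∣ →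
    ∀ a b c → Distinct3 a b c → (edge (compl H) a b c ≡ true) ⇔ (s a ≡ s b × s b ≡ s c)
  complement-is-two-cliques 2≤∣s∣ 2≤∣not∘s∣ a b c abc =
    mk⇔ (splits a b c abc) λ (sa≡sb , sb≡sc) → cong not (nonedge (opposite-pair (s a) refl) sa≡sb sb≡sc)
    where
    opposite-pair : ∀ colour → s a ≡ colour → Σ (Vec (Fin n) 2) λ vs → Unique vs × VecAll.All (λ y → s a ≢ s y) vs
    opposite-pair true sa = let vs , unique , in-opposite = distinct-elements 2 (not ∘ s) 2≤∣not∘s∣ in
      vs , unique , VecAll.map (true≢not-true sa) in-opposite
    opposite-pair false sa = let vs , unique , in-s = distinct-elements 2 s 2≤∣s∣ in
      vs , unique , VecAll.map (λ sy sa≡sy → true≢not-true sy (cong not sa) (sym sa≡sy)) in-s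
    nonedge : Σ (Vec (Fin n) 2) (λ vs → Unique vs × VecAll.All (λ y → s a ≢ s y) vs) →
      s a ≡ s b → s b ≡ s c → edge H a b c ≡ false
    nonedge (p ∷ q ∷ [] , (p≢q ∷ []) ∷ [] ∷ [] , a≁p ∷ a≁q ∷ []) sa≡sb sb≡sc =
      monochromatic-nonedge abc sa≡sb sb≡sc p≢q a≁p a≁q

-- Colourings from disconnectedness

¬¬-choice : ∀ {n} {P : Fin n → Set} → (∀ i → ¬ ¬ P i) → ¬ ¬ (∀ i → P i)
¬¬-choice {zero} _ ¬all = ¬all λ ()
¬¬-choice {suc n} ¬¬P ¬all = ¬¬P fzero λ P₀ → ¬¬-choice (¬¬P ∘ fsuc) λ P₊ →
  ¬all λ { fzero → P₀ ; (fsuc i) → P₊ i }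

Adj-sym : ∀ {n} (G : Graph3 n) {x y} → Adj G x y → Adj G y x
Adj-sym G {x} {y} (w , (x≢y , y≢w , x≢w) , e) = w , (x≢y ∘ sym , x≢w , y≢w) , trans (sym₁₂ G y x w) e

SplittingColouring : ∀ {n} → Graph3 n → Set
SplittingColouring {n} G = Σ (Fin n → Bool) λ s → Splits G s × (∃ λ x → s x ≡ true) × (∃ λ y → s y ≡ false)

-- Colour by reachability from u; deciding reachability is only possible classically here.
component-colouring : ∀ {n} (G : Graph3 n) → Disconnected G → ¬ ¬ SplittingColouring G
component-colouring {n} G (u , v , u↛v) = ¬¬-map colouring (¬¬-choice λ w → ¬¬-excluded-middle)
  where
  colouring : (∀ w → Dec (Star (Adj G) u w)) → SplittingColouring G
  colouring reach? = (λ w → does (reach? w)) , splits , (u , dec-true (reach? u) ε) , (v , dec-false (reach? v) u↛v)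
    where
    same-side : ∀ {x y} → Adj G x y → does (reach? x) ≡ does (reach? y)
    same-side {x} {y} xy with reach? x | reach? y
    ... | yes _ | yes _ = refl
    ... | no _ | no _ = refl
    ... | yes u↝x | no u↛y = contradiction (u↝x ◅◅ (xy ◅ ε)) u↛y
    ... | no u↛x | yes u↝y = contradiction (u↝y ◅◅ (Adj-sym G xy ◅ ε)) u↛x
    splits : Splits G (λ w → does (reach? w))
    splits a b c abc@(a≢b , b≢c , a≢c) e = same-side (c , abc , e) ,
      same-side (a , (b≢c , a≢c ∘ sym , a≢b ∘ sym) , trans (sym (sym₂₃ G b a c)) (trans (sym₁₂ G b a c) e))

record MinoritySplit {n} (G : Graph3 n) : Set where
  field
    side : Fin n → Bool
    splits : Splits G side
    nonempty : ∃ λ x → side x ≡ true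
    minority : ∣ side ∣ ≤ ∣ not ∘ side ∣

minority-split : ∀ {n} (G : Graph3 n) → SplittingColouring G → MinoritySplit G
minority-split G (s , splits , (x , sx) , (y , sy)) with ≤-total ∣ s ∣ ∣ not ∘ s ∣
... | inj₁ ∣s∣≤ = record { side = s ; splits = splits ; nonempty = x , sx ; minority = ∣s∣≤ }
... | inj₂ ∣not∘s∣≤ = record
  { side = not ∘ s
  ; splits = λ a b c abc e → let sa≡sb , sb≡sc = splits a b c abc e in cong not sa≡sb , cong not sb≡sc
  ; nonempty = y , cong not sy
  ; minority = subst (∣ not ∘ s ∣ ≤_) (sum-cong-≗ λ x → cong 𝟙 (sym (not-involutive (s x)))) ∣not∘s∣≤
  }

_⇔-dec_ : ∀ {A B : Set} → Dec A → Dec B → Dec (A ⇔ B)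
A? ⇔-dec B? = map′ (uncurry mk⇔) (λ A⇔B → Equivalence.to A⇔B , Equivalence.from A⇔B) ((A? →-dec B?) ×-dec (B? →-dec A?))

-- Search over colourings, given as subsets (boolean vectors).
DisjUnionCliques? : ∀ {n} (G : Graph3 n) p q → Dec (DisjUnionCliques G p q)
DisjUnionCliques? {n} G p q =
  map′ (λ (vs , P) → lookup vs , P) (λ (s , P) → tabulate s , respects (sym ∘ lookup∘tabulate s) P)
    (anySubset? (two-cliques? ∘ lookup))
  where
  TwoCliques : (Fin n → Bool) → Set
  TwoCliques s = countTrue s ≡ p × countTrue (not ∘ s) ≡ q ×
    (∀ a b c → Distinct3 a b c → (edge G a b c ≡ true) ⇔ (s a ≡ s b × s b ≡ s c))
  two-cliques? : ∀ s → Dec (TwoCliques s)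
  two-cliques? s = countTrue s ℕ.≟ p ×-dec countTrue (not ∘ s) ℕ.≟ q ×-dec
    Finₚ.all? λ a → Finₚ.all? λ b → Finₚ.all? λ c →
      (¬? (a Finₚ.≟ b) ×-dec ¬? (b Finₚ.≟ c) ×-dec ¬? (a Finₚ.≟ c)) →-dec
      ((edge G a b c Boolₚ.≟ true) ⇔-dec ((s a Boolₚ.≟ s b) ×-dec (s b Boolₚ.≟ s c)))
  countTrue-cong : ∀ {s t : Fin n → Bool} → (∀ x → s x ≡ t x) → countTrue s ≡ countTrue t
  countTrue-cong {s} {t} s≗t = trans (countTrue≡∣∣ s) (trans (sum-cong-≗ (cong 𝟙 ∘ s≗t)) (sym (countTrue≡∣∣ t)))
  respects : ∀ {s t} → (∀ x → s x ≡ t x) → TwoCliques s → TwoCliques t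
  respects {s} {t} s≗t (∣s∣≡p , ∣not∘s∣≡q , cliques) =
    trans (sym (countTrue-cong s≗t)) ∣s∣≡p , trans (sym (countTrue-cong (cong not ∘ s≗t))) ∣not∘s∣≡q ,
    λ a b c abc → mk⇔
      (λ e → let sa≡sb , sb≡sc = Equivalence.to (cliques a b c abc) e in
        trans (sym (s≗t a)) (trans sa≡sb (s≗t b)) , trans (sym (s≗t b)) (trans sb≡sc (s≗t c)))
      (λ (ta≡tb , tb≡tc) → Equivalence.from (cliques a b c abc)
        (trans (s≗t a) (trans ta≡tb (sym (s≗t b))) , trans (s≗t b) (trans tb≡tc (sym (s≗t c)))))

-- Arithmetic of the two extremal configurations

BalancedMinimum : ℕ → ℕ → ℕ → ℕ → Set
BalancedMinimum n t p q = ∀ a b → 2 ≤ a → a ≤ b → a + b ≡ n →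
  t ≤ a C 3 + b C 3 × (a C 3 + b C 3 ≡ t → a ≡ p × b ≡ q)

-- 3/10 is the density forced on the n − 1 vertices opposite a single vertex.
BeatenBySingleton : ℕ → ℕ → Set
BeatenBySingleton n t = ∀ b → 1 + b ≡ n → 10 * t < 3 * (b C 3)

-- a = 2 + j and b = a + 2d (resp. a + 2d + 1)
even-excess : ∀ j d → (2 + j) C 3 + (2 + (j + 2 * d)) C 3 ≡ 2 * ((2 + (j + d)) C 3) + d * d * (1 + (j + d))
even-excess j d = *-cancelˡ-≡ _ _ 6 (begin
  6 * ((2 + j) C 3 + (2 + (j + 2 * d)) C 3)                ≡⟨ *-distribˡ-+ 6 ((2 + j) C 3) _ ⟩
  6 * ((2 + j) C 3) + 6 * ((2 + (j + 2 * d)) C 3)          ≡⟨ cong₂ _+_ (6*C3 j) (6*C3 (j + 2 * d)) ⟩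
  (2 + j) * (1 + j) * j + (2 + (j + 2 * d)) * (1 + (j + 2 * d)) * (j + 2 * d)  ≡⟨ poly j d ⟩
  2 * ((2 + (j + d)) * (1 + (j + d)) * (j + d)) + 6 * (d * d * (1 + (j + d)))
    ≡⟨ cong (λ x → 2 * x + 6 * (d * d * (1 + (j + d)))) (6*C3 (j + d)) ⟨
  2 * (6 * ((2 + (j + d)) C 3)) + 6 * (d * d * (1 + (j + d)))  ≡⟨ factor-6 ((2 + (j + d)) C 3) (d * d * (1 + (j + d))) ⟩
  6 * (2 * ((2 + (j + d)) C 3) + d * d * (1 + (j + d)))    ∎)
  where
  open ≡-Reasoning
  poly : ∀ j d → (2 + j) * (1 + j) * j + (2 + (j + 2 * d)) * (1 + (j + 2 * d)) * (j + 2 * d)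
    ≡ 2 * ((2 + (j + d)) * (1 + (j + d)) * (j + d)) + 6 * (d * d * (1 + (j + d)))
  poly = solve-∀
  factor-6 : ∀ x y → 2 * (6 * x) + 6 * y ≡ 6 * (2 * x + y)
  factor-6 = solve-∀

odd-excess : ∀ j d → 2 * ((2 + j) C 3 + (3 + (j + 2 * d)) C 3)
  ≡ 2 * ((2 + (j + d)) C 3 + (3 + (j + d)) C 3) + (3 + 2 * (j + d)) * (d * (1 + d))
odd-excess j d = *-cancelˡ-≡ _ _ 6 (begin
  6 * (2 * ((2 + j) C 3 + (3 + (j + 2 * d)) C 3))          ≡⟨ distribute ((2 + j) C 3) ((3 + (j + 2 * d)) C 3) ⟩
  2 * (6 * ((2 + j) C 3) + 6 * ((3 + (j + 2 * d)) C 3))    ≡⟨ cong₂ (λ x y → 2 * (x + y)) (6*C3 j) (6*C3 (suc (j + 2 * d))) ⟩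
  2 * ((2 + j) * (1 + j) * j + (3 + (j + 2 * d)) * (2 + (j + 2 * d)) * (1 + (j + 2 * d)))  ≡⟨ poly j d ⟩
  2 * ((2 + (j + d)) * (1 + (j + d)) * (j + d) + (3 + (j + d)) * (2 + (j + d)) * (1 + (j + d)))
    + 6 * ((3 + 2 * (j + d)) * (d * (1 + d)))
    ≡⟨ cong₂ (λ x y → 2 * (x + y) + 6 * ((3 + 2 * (j + d)) * (d * (1 + d)))) (6*C3 (j + d)) (6*C3 (suc (j + d))) ⟨
  2 * (6 * ((2 + (j + d)) C 3) + 6 * ((3 + (j + d)) C 3)) + 6 * ((3 + 2 * (j + d)) * (d * (1 + d)))
    ≡⟨ factor-6 ((2 + (j + d)) C 3) ((3 + (j + d)) C 3) ((3 + 2 * (j + d)) * (d * (1 + d))) ⟩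
  6 * (2 * ((2 + (j + d)) C 3 + (3 + (j + d)) C 3) + (3 + 2 * (j + d)) * (d * (1 + d)))  ∎)
  where
  open ≡-Reasoning
  distribute : ∀ x y → 6 * (2 * (x + y)) ≡ 2 * (6 * x + 6 * y)
  distribute = solve-∀
  poly : ∀ j d → 2 * ((2 + j) * (1 + j) * j + (3 + (j + 2 * d)) * (2 + (j + 2 * d)) * (1 + (j + 2 * d)))
    ≡ 2 * ((2 + (j + d)) * (1 + (j + d)) * (j + d) + (3 + (j + d)) * (2 + (j + d)) * (1 + (j + d)))
      + 6 * ((3 + 2 * (j + d)) * (d * (1 + d)))
  poly = solve-∀
  factor-6 : ∀ x y z → 2 * (6 * x + 6 * y) + 6 * z ≡ 6 * (2 * (x + y) + z)
  factor-6 = solve-∀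

twice-smaller : ∀ {a b c} → a ≤ b → a + b ≡ c → 2 * a ≤ c
twice-smaller {a} {b} a≤b refl = subst (_≤ a + b) (cong (a +_) (sym (+-identityʳ a))) (+-monoʳ-≤ a a≤b)

private
  even-split : ∀ j d → 2 * (2 + j + d) ≡ 2 + j + (2 + (j + 2 * d))
  even-split = solve-∀

  odd-split : ∀ j d → 2 * (2 + j + d) + 1 ≡ 2 + j + (3 + (j + 2 * d))
  odd-split = solve-∀

  odd-succ : ∀ m → suc (2 * m + 1) ≡ 2 * suc m
  odd-succ = solve-∀

even-minimum : ∀ m → BalancedMinimum (2 * m) (2 * (m C 3)) m m
even-minimum m a b 2≤a a≤b a+b≡2m
  with j , refl ← m≤n⇒∃[o]m+o≡n {2} {a} 2≤a
  with d , refl ← m≤n⇒∃[o]m+o≡n {2 + j} {m} (*-cancelˡ-≤ 2 (twice-smaller a≤b a+b≡2m))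
  with refl ← +-cancelˡ-≡ (2 + j) b (2 + (j + 2 * d)) (trans a+b≡2m (even-split j d)) =
  subst (2 * ((2 + (j + d)) C 3) ≤_) (sym (even-excess j d)) (m≤m+n _ _) ,
  λ balanced → equal-halves d (+-cancelˡ-≡ _ _ 0 (trans (sym (even-excess j d)) (trans balanced (sym (+-identityʳ _)))))
  where
  equal-halves : ∀ d → d * d * (1 + (j + d)) ≡ 0 → 2 + j ≡ 2 + (j + d) × 2 + (j + 2 * d) ≡ 2 + (j + d)
  equal-halves zero _ = cong (2 +_) (sym (+-identityʳ j)) , refl

odd-minimum : ∀ m → BalancedMinimum (2 * m + 1) (m C 3 + (m + 1) C 3) m (m + 1)
odd-minimum m a b 2≤a a≤b a+b≡2m+1
  with j , refl ← m≤n⇒∃[o]m+o≡n {2} {a} 2≤a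
  with d , refl ← m≤n⇒∃[o]m+o≡n {2 + j} {m}
    (≤-pred (*-cancelˡ-< 2 a (suc m) (subst (suc (2 * a) ≤_) (odd-succ m) (s≤s (twice-smaller a≤b a+b≡2m+1)))))
  with refl ← +-cancelˡ-≡ (2 + j) b (3 + (j + 2 * d)) (trans a+b≡2m+1 (odd-split j d)) =
  subst (λ m+1 → (2 + (j + d)) C 3 + m+1 C 3 ≤ (2 + j) C 3 + (3 + (j + 2 * d)) C 3) m+1≡
    (*-cancelˡ-≤ 2 (subst (2 * ((2 + (j + d)) C 3 + (3 + (j + d)) C 3) ≤_) (sym (odd-excess j d)) (m≤m+n _ _))) ,
  λ balanced → equal-halves d (+-cancelˡ-≡ _ _ 0 (trans (sym (odd-excess j d))
    (trans (cong (2 *_) (trans balanced (cong (λ m+1 → (2 + (j + d)) C 3 + m+1 C 3) (sym m+1≡)))) (sym (+-identityʳ _)))))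
  where
  m+1≡ : 3 + (j + d) ≡ 2 + (j + d) + 1
  m+1≡ = +-comm 1 (2 + (j + d))
  equal-halves : ∀ d → (3 + 2 * (j + d)) * (d * (1 + d)) ≡ 0 → 2 + j ≡ 2 + (j + d) × 3 + (j + 2 * d) ≡ 2 + (j + d) + 1
  equal-halves zero _ = cong (2 +_) (sym (+-identityʳ j)) , +-comm 1 (2 + (j + 0))

private
  even-pred : ∀ k → 2 * (3 + k) ≡ suc (5 + 2 * k)
  even-pred = solve-∀

  odd-pred : ∀ k → 2 * (3 + k) + 1 ≡ suc (6 + 2 * k)
  odd-pred = solve-∀

even-singleton : ∀ m → 3 ≤ m → BeatenBySingleton (2 * m) (2 * (m C 3))
even-singleton m 3≤m b 1+b≡2m
  with k , refl ← m≤n⇒∃[o]m+o≡n {3} {m} 3≤m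
  with refl ← suc-injective (trans 1+b≡2m (even-pred k)) = *-cancelˡ-< 6 _ _ (begin-strict
  6 * (10 * (2 * ((3 + k) C 3)))        ≡⟨ regroup ((3 + k) C 3) ⟩
  20 * (6 * ((3 + k) C 3))              ≡⟨ cong (20 *_) (6*C3 (suc k)) ⟩
  20 * ((3 + k) * (2 + k) * (1 + k))    <⟨ m<m+n _ z<s ⟩
  20 * ((3 + k) * (2 + k) * (1 + k)) + suc (59 + 62 * k + 24 * (k * k) + 4 * (k * k * k))  ≡⟨ poly k ⟩
  3 * ((5 + 2 * k) * (4 + 2 * k) * (3 + 2 * k))  ≡⟨ cong (3 *_) (6*C3 (3 + 2 * k)) ⟨
  3 * (6 * ((5 + 2 * k) C 3))           ≡⟨ x*[y*z]≡y*[x*z] 3 6 ((5 + 2 * k) C 3) ⟩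
  6 * (3 * ((5 + 2 * k) C 3))           ∎)
  where
  open ≤-Reasoning
  regroup : ∀ x → 6 * (10 * (2 * x)) ≡ 20 * (6 * x)
  regroup = solve-∀
  poly : ∀ k → 20 * ((3 + k) * (2 + k) * (1 + k)) + suc (59 + 62 * k + 24 * (k * k) + 4 * (k * k * k))
    ≡ 3 * ((5 + 2 * k) * (4 + 2 * k) * (3 + 2 * k))
  poly = solve-∀

odd-singleton : ∀ m → 3 ≤ m → BeatenBySingleton (2 * m + 1) (m C 3 + (m + 1) C 3)
odd-singleton m 3≤m b 1+b≡2m+1
  with k , refl ← m≤n⇒∃[o]m+o≡n {3} {m} 3≤m
  with refl ← suc-injective (trans 1+b≡2m+1 (odd-pred k)) = *-cancelˡ-< 6 _ _ (begin-strict
  6 * (10 * ((3 + k) C 3 + (3 + k + 1) C 3))  ≡⟨ cong (λ m+1 → 6 * (10 * ((3 + k) C 3 + m+1 C 3))) (+-comm (3 + k) 1) ⟩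
  6 * (10 * ((3 + k) C 3 + (4 + k) C 3))      ≡⟨ regroup ((3 + k) C 3) ((4 + k) C 3) ⟩
  10 * (6 * ((3 + k) C 3) + 6 * ((4 + k) C 3))  ≡⟨ cong₂ (λ x y → 10 * (x + y)) (6*C3 (1 + k)) (6*C3 (2 + k)) ⟩
  10 * ((3 + k) * (2 + k) * (1 + k) + (4 + k) * (3 + k) * (2 + k))  <⟨ m<m+n _ z<s ⟩
  10 * ((3 + k) * (2 + k) * (1 + k) + (4 + k) * (3 + k) * (2 + k)) + suc (59 + 74 * k + 30 * (k * k) + 4 * (k * k * k))
                                              ≡⟨ poly k ⟩
  3 * ((6 + 2 * k) * (5 + 2 * k) * (4 + 2 * k))  ≡⟨ cong (3 *_) (6*C3 (4 + 2 * k)) ⟨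
  3 * (6 * ((6 + 2 * k) C 3))                 ≡⟨ x*[y*z]≡y*[x*z] 3 6 ((6 + 2 * k) C 3) ⟩
  6 * (3 * ((6 + 2 * k) C 3))                 ∎)
  where
  open ≤-Reasoning
  regroup : ∀ x y → 6 * (10 * (x + y)) ≡ 10 * (6 * x + 6 * y)
  regroup = solve-∀
  poly : ∀ k → 10 * ((3 + k) * (2 + k) * (1 + k) + (4 + k) * (3 + k) * (2 + k)) + suc (59 + 74 * k + 30 * (k * k) + 4 * (k * k * k))
    ≡ 3 * ((6 + 2 * k) * (5 + 2 * k) * (4 + 2 * k))
  poly = solve-∀

C3-of-even : ∀ k → (2 * (3 + k)) C 3 ≡ (3 + k) * (3 + k) * (2 + k) + 2 * ((3 + k) C 3)
C3-of-even k = *-cancelˡ-≡ _ _ 6 (begin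
  6 * ((2 * (3 + k)) C 3)                       ≡⟨ cong (λ n → 6 * (n C 3)) (double k) ⟩
  6 * ((6 + 2 * k) C 3)                         ≡⟨ 6*C3 (4 + 2 * k) ⟩
  (6 + 2 * k) * (5 + 2 * k) * (4 + 2 * k)       ≡⟨ poly k ⟩
  6 * ((3 + k) * (3 + k) * (2 + k)) + 2 * ((3 + k) * (2 + k) * (1 + k))
    ≡⟨ cong (λ x → 6 * ((3 + k) * (3 + k) * (2 + k)) + 2 * x) (6*C3 (1 + k)) ⟨
  6 * ((3 + k) * (3 + k) * (2 + k)) + 2 * (6 * ((3 + k) C 3))  ≡⟨ factor-6 ((3 + k) * (3 + k) * (2 + k)) ((3 + k) C 3) ⟩
  6 * ((3 + k) * (3 + k) * (2 + k) + 2 * ((3 + k) C 3))  ∎)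
  where
  open ≡-Reasoning
  double : ∀ k → 2 * (3 + k) ≡ 6 + 2 * k
  double = solve-∀
  poly : ∀ k → (6 + 2 * k) * (5 + 2 * k) * (4 + 2 * k) ≡ 6 * ((3 + k) * (3 + k) * (2 + k)) + 2 * ((3 + k) * (2 + k) * (1 + k))
  poly = solve-∀
  factor-6 : ∀ x y → 6 * x + 2 * (6 * y) ≡ 6 * (x + 2 * y)
  factor-6 = solve-∀

twice-C3-of-odd : ∀ k → 2 * ((2 * (3 + k) + 1) C 3) ≡ (3 + k) * (4 + k) * (5 + 2 * k) + 2 * ((3 + k) C 3 + (4 + k) C 3)
twice-C3-of-odd k = *-cancelˡ-≡ _ _ 6 (begin
  6 * (2 * ((2 * (3 + k) + 1) C 3))             ≡⟨ cong (λ n → 6 * (2 * (n C 3))) (double+1 k) ⟩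
  6 * (2 * ((7 + 2 * k) C 3))                   ≡⟨ x*[y*z]≡y*[x*z] 6 2 ((7 + 2 * k) C 3) ⟩
  2 * (6 * ((7 + 2 * k) C 3))                   ≡⟨ cong (2 *_) (6*C3 (5 + 2 * k)) ⟩
  2 * ((7 + 2 * k) * (6 + 2 * k) * (5 + 2 * k)) ≡⟨ poly k ⟩
  6 * ((3 + k) * (4 + k) * (5 + 2 * k)) + 2 * ((3 + k) * (2 + k) * (1 + k) + (4 + k) * (3 + k) * (2 + k))
    ≡⟨ cong₂ (λ x y → 6 * ((3 + k) * (4 + k) * (5 + 2 * k)) + 2 * (x + y)) (6*C3 (1 + k)) (6*C3 (2 + k)) ⟨
  6 * ((3 + k) * (4 + k) * (5 + 2 * k)) + 2 * (6 * ((3 + k) C 3) + 6 * ((4 + k) C 3))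
    ≡⟨ factor-6 ((3 + k) * (4 + k) * (5 + 2 * k)) ((3 + k) C 3) ((4 + k) C 3) ⟩
  6 * ((3 + k) * (4 + k) * (5 + 2 * k) + 2 * ((3 + k) C 3 + (4 + k) C 3))  ∎)
  where
  open ≡-Reasoning
  double+1 : ∀ k → 2 * (3 + k) + 1 ≡ 7 + 2 * k
  double+1 = solve-∀
  poly : ∀ k → 2 * ((7 + 2 * k) * (6 + 2 * k) * (5 + 2 * k))
    ≡ 6 * ((3 + k) * (4 + k) * (5 + 2 * k)) + 2 * ((3 + k) * (2 + k) * (1 + k) + (4 + k) * (3 + k) * (2 + k))
  poly = solve-∀
  factor-6 : ∀ x y z → 6 * x + 2 * (6 * y + 6 * z) ≡ 6 * (x + 2 * (y + z))
  factor-6 = solve-∀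

≤-of-+≡+ : ∀ {e n x y} → e + n ≡ x + y → y ≤ n → e ≤ x
≤-of-+≡+ {e} {n} {x} {y} e+n≡x+y y≤n = +-cancelʳ-≤ y e x (≤-trans (+-monoʳ-≤ e y≤n) (≤-reflexive e+n≡x+y))

even-edge-bound : ∀ m {E N} → 3 ≤ m → E + N ≡ (2 * m) C 3 → 2 * (m C 3) ≤ N → E ≤ m * m * (m ∸ 1)
even-edge-bound m 3≤m E+N≡ lower with k , refl ← m≤n⇒∃[o]m+o≡n {3} {m} 3≤m =
  ≤-of-+≡+ (trans E+N≡ (C3-of-even k)) lower

odd-edge-bound : ∀ m {E N} → 3 ≤ m → E + N ≡ (2 * m + 1) C 3 → m C 3 + (m + 1) C 3 ≤ N →
  2 * E ≤ 2 * (m * m * m) + m * m ∸ m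
odd-edge-bound m {E} {N} 3≤m E+N≡ lower with k , refl ← m≤n⇒∃[o]m+o≡n {3} {m} 3≤m =
  subst (2 * E ≤_) (sym cubic) (≤-of-+≡+ (trans (sym (*-distribˡ-+ 2 E N)) (trans (cong (2 *_) E+N≡) (twice-C3-of-odd k)))
    (*-monoʳ-≤ 2 (subst (λ m+1 → (3 + k) C 3 + m+1 C 3 ≤ N) (+-comm (3 + k) 1) lower)))
  where
  poly : ∀ k → 2 * ((3 + k) * (3 + k) * (3 + k)) + (3 + k) * (3 + k) ≡ (3 + k) * (4 + k) * (5 + 2 * k) + (3 + k)
  poly = solve-∀
  cubic : 2 * ((3 + k) * (3 + k) * (3 + k)) + (3 + k) * (3 + k) ∸ (3 + k) ≡ (3 + k) * (4 + k) * (5 + 2 * k)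
  cubic = trans (cong (_∸ (3 + k)) (poly k)) (m+n∸n≡m _ (3 + k))

complement-bound : ∀ {n} (H : Graph3 n) → 6 ≤ n → K5Free H → MinoritySplit (compl H) →
  ∀ {t p q} → BalancedMinimum n t p q → BeatenBySingleton n t →
  t ≤ numEdges (compl H) × (numEdges (compl H) ≡ t → DisjUnionCliques (compl H) p q)
complement-bound {n} H 6≤n K5-free split {t} balanced singleton with m≤n⇒m<n∨m≡n 1≤∣side∣
  where
  open MinoritySplit split
  1≤∣side∣ : 1 ≤ ∣ side ∣
  1≤∣side∣ = let x , side-x = nonempty in subst (λ b → 𝟙 b ≤ ∣ side ∣) side-x (term≤∑ (λ y → 𝟙 (side y)) x)
... | inj₂ 1≡∣side∣ = <⇒≤ t<Nc , λ Nc≡t → contradiction (sym Nc≡t) (<⇒≢ t<Nc)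
  where
  open MinoritySplit split
  1+b≡n : 1 + ∣ not ∘ side ∣ ≡ n
  1+b≡n = trans (cong (_+ ∣ not ∘ side ∣) 1≡∣side∣) (∣∣+∣not∣ side)
  t<Nc : t < numEdges (compl H)
  t<Nc with v , b≡5+v ← m≤n⇒∃[o]m+o≡n {5} {∣ not ∘ side ∣} (≤-pred (subst (6 ≤_) (sym 1+b≡n) 6≤n)) =
    *-cancelˡ-< 10 t _ (begin-strict
    10 * t                                         <⟨ singleton _ 1+b≡n ⟩
    3 * (∣ not ∘ side ∣ C 3)                       ≡⟨ cong (λ b → 3 * (b C 3)) b≡5+v ⟨
    3 * ((5 + v) C 3)                              ≤⟨ covering-density (compl H) v (not ∘ side) (sym b≡5+v)
                                                        (complement-covers-opposite-side H K5-free side splits (proj₂ nonempty)) ⟩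
    10 * #triples (edge (compl H)) (not ∘ side)    ≤⟨ *-monoʳ-≤ 10 (#triples≤numEdges (compl H) (not ∘ side)) ⟩
    10 * numEdges (compl H)                        ∎)
    where open ≤-Reasoning
... | inj₁ 2≤∣side∣ with balanced _ _ 2≤∣side∣ minority (∣∣+∣not∣ side)
  where open MinoritySplit split
... | lower , extremal = subst (t ≤_) (sym Nc≡) lower , λ Nc≡t →
  let ∣side∣≡p , ∣not∘side∣≡q = extremal (trans (sym Nc≡) Nc≡t) in
  side , trans (countTrue≡∣∣ side) ∣side∣≡p , trans (countTrue≡∣∣ (not ∘ side)) ∣not∘side∣≡q , cliques
  where
  open MinoritySplit split
  cliques : ∀ a b c → Distinct3 a b c → (edge (compl H) a b c ≡ true) ⇔ (side a ≡ side b × side b ≡ side c)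
  cliques = complement-is-two-cliques H K5-free side splits 2≤∣side∣ (≤-trans 2≤∣side∣ minority)
  Nc≡ : numEdges (compl H) ≡ ∣ side ∣ C 3 + ∣ not ∘ side ∣ C 3
  Nc≡ = numEdges-two-cliques (compl H) side cliques

-- Every conclusion is decidable, so the classically obtained colouring suffices.
complement-bound-stable : ∀ {n} (H : Graph3 n) → 6 ≤ n → K5Free H → Disconnected (compl H) →
  ∀ {t p q} → BalancedMinimum n t p q → BeatenBySingleton n t →
  t ≤ numEdges (compl H) × (numEdges (compl H) ≡ t → DisjUnionCliques (compl H) p q)
complement-bound-stable H 6≤n K5-free disconnected {t} {p} {q} balanced singleton =
  decidable-stable (t ℕ.≤? numEdges (compl H)) (¬¬-map proj₁ bound) ,
  λ Nc≡t → decidable-stable (DisjUnionCliques? (compl H) p q) (¬¬-map (λ b → proj₂ b Nc≡t) bound)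
  where
  bound : ¬ ¬ (t ≤ numEdges (compl H) × (numEdges (compl H) ≡ t → DisjUnionCliques (compl H) p q))
  bound = ¬¬-map (λ colouring → complement-bound H 6≤n K5-free (minority-split (compl H) colouring) balanced singleton)
    (component-colouring (compl H) disconnected)

even-case : ∀ {n} (H : Graph3 n) → 6 ≤ n → K5Free H → Disconnected (compl H) → ∀ m → n ≡ 2 * m →
  (2 * (m C 3) ≤ numEdges (compl H)) × (numEdges H ≤ m * m * (m ∸ 1))
    × ((numEdges (compl H) ≡ 2 * (m C 3)) ⇔ DisjUnionCliques (compl H) m m)
even-case H 6≤n K5-free disconnected m refl =
  proj₁ bound , even-edge-bound m 3≤m (numEdges+numEdges-compl H) (proj₁ bound) ,
  mk⇔ (proj₂ bound) λ cliques → trans (numEdges-DisjUnionCliques (compl H) cliques) (cong (m C 3 +_) (sym (+-identityʳ (m C 3))))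
  where
  3≤m : 3 ≤ m
  3≤m = *-cancelˡ-≤ 2 6≤n
  bound : 2 * (m C 3) ≤ numEdges (compl H) × (numEdges (compl H) ≡ 2 * (m C 3) → DisjUnionCliques (compl H) m m)
  bound = complement-bound-stable H 6≤n K5-free disconnected (even-minimum m) (even-singleton m 3≤m)

odd-case : ∀ {n} (H : Graph3 n) → 6 ≤ n → K5Free H → Disconnected (compl H) → ∀ m → n ≡ 2 * m + 1 →
  (m C 3 + (m + 1) C 3 ≤ numEdges (compl H)) × (2 * numEdges H ≤ 2 * (m * m * m) + m * m ∸ m)
    × ((numEdges (compl H) ≡ m C 3 + (m + 1) C 3) ⇔ DisjUnionCliques (compl H) m (m + 1))
odd-case H 6≤n K5-free disconnected m refl =
  proj₁ bound , odd-edge-bound m 3≤m (numEdges+numEdges-compl H) (proj₁ bound) ,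
  mk⇔ (proj₂ bound) (numEdges-DisjUnionCliques (compl H))
  where
  3≤m : 3 ≤ m
  3≤m = *-cancelˡ-< 2 2 m (≤-pred (subst (6 ≤_) (+-comm (2 * m) 1) 6≤n))
  bound : m C 3 + (m + 1) C 3 ≤ numEdges (compl H) ×
    (numEdges (compl H) ≡ m C 3 + (m + 1) C 3 → DisjUnionCliques (compl H) m (m + 1))
  bound = complement-bound-stable H 6≤n K5-free disconnected (odd-minimum m) (odd-singleton m 3≤m)

theorem3p2 : ∀ {n} (H : Graph3 n) → 6 ≤ n → K5Free H → Disconnected (compl H) →
    (∀ m → n ≡ 2 * m →
       (2 * (m C 3) ≤ numEdges (compl H))
       × (numEdges H ≤ m * m * (m ∸ 1))
       × ((numEdges (compl H) ≡ 2 * (m C 3)) ⇔ DisjUnionCliques (compl H) m m))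
    × (∀ m → n ≡ 2 * m + 1 →
       (m C 3 + (m + 1) C 3 ≤ numEdges (compl H))
       × (2 * numEdges H ≤ 2 * (m * m * m) + m * m ∸ m)
       × ((numEdges (compl H) ≡ m C 3 + (m + 1) C 3) ⇔ DisjUnionCliques (compl H) m (m + 1)))
theorem3p2 H 6≤n K5-free disconnected = even-case H 6≤n K5-free disconnected , odd-case H 6≤n K5-free disconnected
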